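{- Let $\mathbf U=\langle\langle U,\approx\rangle,\preceq\rangle$ be a completely lattice $\mathbf L$-ordered set and $\sim$ a complete $\mathbf L$-tolerance on $\mathbf U$. For each $u\in U$, $(u\sim u_\sim)=(u\sim u^\sim)=1$.
   Context: $\mathbf L=\langle L,\wedge,\vee,\otimes,\to,0,1\rangle$ is a complete residuated lattice ($\langle L,\wedge,\vee,0,1\rangle$ complete lattice, $\langle L,\otimes,1\rangle$ commutative monoid, $a\otimes b\le c$ iff $a\le b\to c$). An $\mathbf L$-set in $X$ is a map $X\to L$; $L^X$ the set of them; $S(A,B)=\bigwedge_x(A(x)\to B(x))$. An $\mathbf L$-equality is a binary $\mathbf L$-relation that is reflexive, symmetric, transitive ($R(x,y)\otimes R(y,z)\le R(x,z)$) and with $R(x,y)=1\Rightarrow x=y$. An $\mathbf L$-ordered set is $\langle\langle U,\approx\rangle,\preceq\rangle$, $\approx$ an $\mathbf L$-equality, $\preceq$ reflexive, transitive, compatible with $\approx$ ($(u\preceq v)\otimes(u\approx u')\otimes(v\approx v')\le(u'\preceq v')$), and $(u\preceq v)\wedge(v\preceq u)\le u\approx v$. For $V\in L^U$: $\mathcal L V(v)=\bigwedge_u(V(u)\to(v\preceq u))$, $\mathcal U V(v)=\bigwedge_u(V(u)\to(u\preceq v))$; $\inf V$ is the unique $u$ with $\mathcal L V(u)=1=\mathcal U(\mathcal L V)(u)$, $\sup V$ the unique $u$ with $\mathcal U V(u)=1=\mathcal L(\mathcal U V)(u)$; completely lattice means these exist for all $V$. Power relation: for $R$ on $X$, $A,B\in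 L^X$, $(R\circ B)(x)=\bigvee_y R(x,y)\otimes B(y)$, $(A\circ R)(y)=\bigvee_x A(x)\otimes R(x,y)$, $R^+(A,B)=S(A,R\circ B)\wedge S(B,A\circ R)$. A binary $\mathbf L$-relation $R$ on $\mathbf U$ is complete if it is compatible with $\approx$ ($R(u,v)\otimes(u\approx u')\otimes(v\approx v')\le R(u',v')$) and $R^+(V_1,V_2)\le R(\inf V_1,\inf V_2)$, $R^+(V_1,V_2)\le R(\sup V_1,\sup V_2)$ for all $V_1,V_2\in L^U$. An $\mathbf L$-tolerance is a reflexive symmetric binary $\mathbf L$-relation. For $u\in U$, $[u]_\sim(v)=u\sim v$, $u_\sim=\inf[u]_\sim$, $u^\sim=\sup[u]_\sim$. -}

module Defs where

open import Level using (Level; _⊔_) renaming (suc to lsuc)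
open import Data.Product using (_×_; Σ)
open import Relation.Binary.PropositionalEquality using (_≡_)

-- Complete residuated lattice.  Arbitrary infima/suprema are taken over
-- index types living in universe i (the universe of the underlying sets U).
record CompleteResiduatedLattice (c i : Level) : Set (lsuc (c ⊔ i)) where
  infixr 7 _⊗_
  infixr 6 _∧_
  infixr 5 _∨_
  infixr 4 _⇒_
  infix  3 _≤_
  field
    Carrier : Set c
    _≤_     : Carrier → Carrier → Set c
    _∧_ _∨_ _⊗_ _⇒_ : Carrier → Carrier → Carrier
    𝟘 𝟙     : Carrier
    ⋀ ⋁     : {I : Set i} → (I → Carrier) → Carrier
    ≤-refl    : ∀ {a} → a ≤ a
    ≤-trans   : ∀ {a b d} → a ≤ b → b ≤ d → a ≤ d
    ≤-antisym : ∀ {a b} → a ≤ b → b ≤ a → a ≡ b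
    ∧-lb₁ : ∀ a b → (a ∧ b) ≤ a
    ∧-lb₂ : ∀ a b → (a ∧ b) ≤ b
    ∧-glb : ∀ {a b d} → d ≤ a → d ≤ b → d ≤ (a ∧ b)
    ∨-ub₁ : ∀ a b → a ≤ (a ∨ b)
    ∨-ub₂ : ∀ a b → b ≤ (a ∨ b)
    ∨-lub : ∀ {a b d} → a ≤ d → b ≤ d → (a ∨ b) ≤ d
    𝟘-min : ∀ a → 𝟘 ≤ a
    𝟙-max : ∀ a → a ≤ 𝟙
    ⋀-lb  : ∀ {I : Set i} (f : I → Carrier) (j : I) → ⋀ f ≤ f j
    ⋀-glb : ∀ {I : Set i} (f : I → Carrier) {d} → (∀ j → d ≤ f j) → d ≤ ⋀ f
    ⋁-ub  : ∀ {I : Set i} (f : I → Carrier) (j : I) → f j ≤ ⋁ f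
    ⋁-lub : ∀ {I : Set i} (f : I → Carrier) {d} → (∀ j → f j ≤ d) → ⋁ f ≤ d
    ⊗-assoc    : ∀ a b d → (a ⊗ b) ⊗ d ≡ a ⊗ (b ⊗ d)
    ⊗-comm     : ∀ a b → a ⊗ b ≡ b ⊗ a
    ⊗-identity : ∀ a → a ⊗ 𝟙 ≡ a
    residuation₁ : ∀ {a b d} → a ⊗ b ≤ d → a ≤ b ⇒ d
    residuation₂ : ∀ {a b d} → a ≤ b ⇒ d → a ⊗ b ≤ d

module _ {c i : Level} (𝐋 : CompleteResiduatedLattice c i) where
  open CompleteResiduatedLattice 𝐋

  S : {X : Set i} → (X → Carrier) → (X → Carrier) → Carrier
  S A B = ⋀ (λ x → A x ⇒ B x)

  record IsLEquality {U : Set i} (_≈_ : U → U → Carrier) : Set (c ⊔ i) where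
    field
      refl      : ∀ u → (u ≈ u) ≡ 𝟙
      sym       : ∀ u v → (u ≈ v) ≡ (v ≈ u)
      trans     : ∀ u v w → ((u ≈ v) ⊗ (v ≈ w)) ≤ (u ≈ w)
      separated : ∀ u v → (u ≈ v) ≡ 𝟙 → u ≡ v

  record LOrderedSet : Set (c ⊔ lsuc i) where
    field
      U   : Set i
      _≈_ : U → U → Carrier
      _≼_ : U → U → Carrier
      ≈-isLEquality : IsLEquality _≈_
      ≼-refl    : ∀ u → (u ≼ u) ≡ 𝟙
      ≼-trans   : ∀ u v w → ((u ≼ v) ⊗ (v ≼ w)) ≤ (u ≼ w)
      ≼-compat  : ∀ u v u' v' → ((u ≼ v) ⊗ (u ≈ u') ⊗ (v ≈ v')) ≤ (u' ≼ v')
      ≼-antisym : ∀ u v → ((u ≼ v) ∧ (v ≼ u)) ≤ (u ≈ v)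

  module _ (𝐔 : LOrderedSet) where
    open LOrderedSet 𝐔

    𝓛 : (U → Carrier) → (U → Carrier)
    𝓛 V v = ⋀ (λ u → V u ⇒ (v ≼ u))

    𝓤 : (U → Carrier) → (U → Carrier)
    𝓤 V v = ⋀ (λ u → V u ⇒ (u ≼ v))

    IsInf : (U → Carrier) → U → Set c
    IsInf V u = (𝓛 V u ≡ 𝟙) × (𝓤 (𝓛 V) u ≡ 𝟙)

    IsSup : (U → Carrier) → U → Set c
    IsSup V u = (𝓤 V u ≡ 𝟙) × (𝓛 (𝓤 V) u ≡ 𝟙)

    -- completely lattice L-ordered set: every L-set has an infimum and a
    -- supremum (these are unique, by antisymmetry and separation of ≈).
    record CompletelyLattice : Set (c ⊔ i) where
      field
        inf    : (U → Carrier) → U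
        inf-is : ∀ V → IsInf V (inf V)
        sup    : (U → Carrier) → U
        sup-is : ∀ V → IsSup V (sup V)

    _∘ʳ_ : (U → U → Carrier) → (U → Carrier) → (U → Carrier)
    (R ∘ʳ B) x = ⋁ (λ y → R x y ⊗ B y)

    _ʳ∘_ : (U → Carrier) → (U → U → Carrier) → (U → Carrier)
    (A ʳ∘ R) y = ⋁ (λ x → A x ⊗ R x y)

    _⁺ : (U → U → Carrier) → (U → Carrier) → (U → Carrier) → Carrier
    (R ⁺) A B = S A (R ∘ʳ B) ∧ S B (A ʳ∘ R)

    record IsLTolerance (R : U → U → Carrier) : Set (c ⊔ i) where
      field
        refl : ∀ u → R u u ≡ 𝟙
        sym  : ∀ u v → R u v ≡ R v u

    record IsCompleteRelation (C : CompletelyLattice) (R : U → U → Carrier) : Set (c ⊔ i) where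
      open CompletelyLattice C
      field
        compat  : ∀ u v u' v' → (R u v ⊗ (u ≈ u') ⊗ (v ≈ v')) ≤ R u' v'
        inf-rel : ∀ V₁ V₂ → (R ⁺) V₁ V₂ ≤ R (inf V₁) (inf V₂)
        sup-rel : ∀ V₁ V₂ → (R ⁺) V₁ V₂ ≤ R (sup V₁) (sup V₂)

    -- [u]_∼ , u_∼ and u^∼
    [_]_ : U → (U → U → Carrier) → (U → Carrier)
    [ u ] R = λ v → R u v

    lowerOf : CompletelyLattice → (U → U → Carrier) → U → U
    lowerOf C R u = CompletelyLattice.inf C ([ u ] R)

    upperOf : CompletelyLattice → (U → U → Carrier) → U → U
    upperOf C R u = CompletelyLattice.sup C ([ u ] R)

-- Take V₁ = [u]_≈. Since ∼ is reflexive and compatible with ≈, every v close to u is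
-- ∼-related to u, which makes ∼⁺([u]_≈, [u]_∼) = 1. The L-set [u]_≈ has u as a member
-- (degree u ≈ u = 1) and as a lower and an upper bound, so inf [u]_≈ = sup [u]_≈ = u.
-- Completeness of ∼ now gives u ∼ u_∼ = ∼⁺([u]_≈, [u]_∼) = 1, and likewise for u^∼.
module Submission where

open import Level using (Level; _⊔_)
open import Data.Product using (_×_; _,_)
open import Relation.Binary.PropositionalEquality
  using (_≡_; refl; sym; trans; subst)
open import Defs

module _ {c i : Level} (𝐋 : CompleteResiduatedLattice c i) where
  open CompleteResiduatedLattice 𝐋

  ≡⇒≤ : ∀ {a b} → a ≡ b → a ≤ b
  ≡⇒≤ refl = ≤-refl

  𝟙≤⇒≡𝟙 : ∀ {a} → 𝟙 ≤ a → a ≡ 𝟙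
  𝟙≤⇒≡𝟙 = ≤-antisym (𝟙-max _)

  ⊗-identityˡ : ∀ a → 𝟙 ⊗ a ≡ a
  ⊗-identityˡ a = trans (⊗-comm 𝟙 a) (⊗-identity a)

  ⊆⇒S≡𝟙 : {X : Set i} {A B : X → Carrier} → (∀ x → A x ≤ B x) → S 𝐋 A B ≡ 𝟙
  ⊆⇒S≡𝟙 A⊆B = 𝟙≤⇒≡𝟙 (⋀-glb _ λ x → residuation₁ (≤-trans (≡⇒≤ (⊗-identityˡ _)) (A⊆B x)))

  S≡𝟙⇒⊆ : {X : Set i} {A B : X → Carrier} → S 𝐋 A B ≡ 𝟙 → ∀ x → A x ≤ B x
  S≡𝟙⇒⊆ {A = A} {B} S≡𝟙 x = ≤-trans (≡⇒≤ (sym (⊗-identityˡ (A x))))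
    (residuation₂ (≤-trans (≡⇒≤ (sym S≡𝟙)) (⋀-lb (λ x → A x ⇒ B x) x)))

  ≤-⋁ : {I : Set i} (f : I → Carrier) (j : I) → ∀ {a} → a ≤ f j → a ≤ ⋁ f
  ≤-⋁ f j a≤fj = ≤-trans a≤fj (⋁-ub f j)

  ≤𝟙⊗ : ∀ {a} b → a ≡ 𝟙 → b ≤ a ⊗ b
  ≤𝟙⊗ b refl = ≡⇒≤ (sym (⊗-identityˡ b))

  𝟙⊗𝟙⊗ : ∀ {a b} d → a ≡ 𝟙 → b ≡ 𝟙 → a ⊗ b ⊗ d ≡ d
  𝟙⊗𝟙⊗ d refl refl = trans (⊗-identityˡ _) (⊗-identityˡ d)

  𝟙⊗⊗𝟙 : ∀ {a b} d → a ≡ 𝟙 → b ≡ 𝟙 → a ⊗ d ⊗ b ≡ d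
  𝟙⊗⊗𝟙 d refl refl = trans (⊗-identityˡ _) (⊗-identity d)

  module _ (𝐔 : LOrderedSet 𝐋) where
    open LOrderedSet 𝐔
    module ≈ = IsLEquality ≈-isLEquality

    Compatible : (U → U → Carrier) → Set (c ⊔ i)
    Compatible R = ∀ u v u' v' → (R u v ⊗ (u ≈ u') ⊗ (v ≈ v')) ≤ R u' v'

    compatible⇒≈≤ʳ : ∀ {R} → Compatible R → ∀ u → R u u ≡ 𝟙 → ∀ v → (u ≈ v) ≤ R u v
    compatible⇒≈≤ʳ compat u Ruu≡𝟙 v =
      ≤-trans (≡⇒≤ (sym (𝟙⊗𝟙⊗ (u ≈ v) Ruu≡𝟙 (≈.refl u)))) (compat u u u v)

    compatible⇒≈≤ˡ : ∀ {R} → Compatible R → ∀ u → R u u ≡ 𝟙 → ∀ v → (u ≈ v) ≤ R v u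
    compatible⇒≈≤ˡ compat u Ruu≡𝟙 v =
      ≤-trans (≡⇒≤ (sym (𝟙⊗⊗𝟙 (u ≈ v) Ruu≡𝟙 (≈.refl u)))) (compat u u v u)

    ≼-both⇒≡ : ∀ {u v} → (u ≼ v) ≡ 𝟙 → (v ≼ u) ≡ 𝟙 → u ≡ v
    ≼-both⇒≡ {u} {v} u≼v v≼u = ≈.separated u v (𝟙≤⇒≡𝟙
      (≤-trans (∧-glb (≡⇒≤ (sym u≼v)) (≡⇒≤ (sym v≼u))) (≼-antisym u v)))

    IsInf-≡-lowerBound-member : ∀ {V w u} → IsInf 𝐋 𝐔 V w → V u ≡ 𝟙 → 𝓛 𝐋 𝐔 V u ≡ 𝟙 → w ≡ u
    IsInf-≡-lowerBound-member {u = u} (w-lower , w-greatest) Vu≡𝟙 u-lower = ≼-both⇒≡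
      (𝟙≤⇒≡𝟙 (≤-trans (≡⇒≤ (sym Vu≡𝟙)) (S≡𝟙⇒⊆ w-lower u)))
      (𝟙≤⇒≡𝟙 (≤-trans (≡⇒≤ (sym u-lower)) (S≡𝟙⇒⊆ w-greatest u)))

    IsSup-≡-upperBound-member : ∀ {V w u} → IsSup 𝐋 𝐔 V w → V u ≡ 𝟙 → 𝓤 𝐋 𝐔 V u ≡ 𝟙 → w ≡ u
    IsSup-≡-upperBound-member {u = u} (w-upper , w-least) Vu≡𝟙 u-upper = sym (≼-both⇒≡
      (𝟙≤⇒≡𝟙 (≤-trans (≡⇒≤ (sym Vu≡𝟙)) (S≡𝟙⇒⊆ w-upper u)))
      (𝟙≤⇒≡𝟙 (≤-trans (≡⇒≤ (sym u-upper)) (S≡𝟙⇒⊆ w-least u))))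

    ≈-class-infimum : (C : CompletelyLattice 𝐋 𝐔) → ∀ u → CompletelyLattice.inf C (u ≈_) ≡ u
    ≈-class-infimum C u = IsInf-≡-lowerBound-member (CompletelyLattice.inf-is C (u ≈_)) (≈.refl u)
      (⊆⇒S≡𝟙 (compatible⇒≈≤ʳ ≼-compat u (≼-refl u)))

    ≈-class-supremum : (C : CompletelyLattice 𝐋 𝐔) → ∀ u → CompletelyLattice.sup C (u ≈_) ≡ u
    ≈-class-supremum C u = IsSup-≡-upperBound-member (CompletelyLattice.sup-is C (u ≈_)) (≈.refl u)
      (⊆⇒S≡𝟙 (compatible⇒≈≤ˡ ≼-compat u (≼-refl u)))

    ⁺-≈-class-class≡𝟙 : ∀ {R} → Compatible R → (∀ v → R v v ≡ 𝟙) → ∀ u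
                       → (_⁺ 𝐋 𝐔 R) (u ≈_) (R u) ≡ 𝟙
    ⁺-≈-class-class≡𝟙 {R} compat R-refl u = 𝟙≤⇒≡𝟙 (∧-glb
      (≡⇒≤ (sym (⊆⇒S≡𝟙 λ v → ≤-⋁ (λ w → R v w ⊗ R u w) v
        (≤-trans (compatible⇒≈≤ʳ compat u (R-refl u) v) (≤𝟙⊗ (R u v) (R-refl v))))))
      (≡⇒≤ (sym (⊆⇒S≡𝟙 λ v → ≤-⋁ (λ w → (u ≈ w) ⊗ R w v) u (≤𝟙⊗ (R u v) (≈.refl u))))))

lemma18 : {c i : Level} (𝐋 : CompleteResiduatedLattice c i) (𝐔 : LOrderedSet 𝐋)
    (C : CompletelyLattice 𝐋 𝐔) (_∼_ : LOrderedSet.U 𝐔 → LOrderedSet.U 𝐔 → CompleteResiduatedLattice.Carrier 𝐋)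
    → IsLTolerance 𝐋 𝐔 _∼_ → IsCompleteRelation 𝐋 𝐔 C _∼_
    → ∀ (u : LOrderedSet.U 𝐔)
    → ((u ∼ lowerOf 𝐋 𝐔 C _∼_ u) ≡ CompleteResiduatedLattice.𝟙 𝐋)
    × ((u ∼ upperOf 𝐋 𝐔 C _∼_ u) ≡ CompleteResiduatedLattice.𝟙 𝐋)
lemma18 𝐋 𝐔 C _∼_ tolerance complete u =
  subst (λ w → (w ∼ lowerOf 𝐋 𝐔 C _∼_ u) ≡ 𝟙) (≈-class-infimum 𝐋 𝐔 C u) (≡𝟙-by (inf-rel _ _)) ,
  subst (λ w → (w ∼ upperOf 𝐋 𝐔 C _∼_ u) ≡ 𝟙) (≈-class-supremum 𝐋 𝐔 C u) (≡𝟙-by (sup-rel _ _))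
  where
  open CompleteResiduatedLattice 𝐋
  open LOrderedSet 𝐔
  open IsCompleteRelation complete

  ∼⁺≡𝟙 : (_⁺ 𝐋 𝐔 _∼_) (u ≈_) (u ∼_) ≡ 𝟙
  ∼⁺≡𝟙 = ⁺-≈-class-class≡𝟙 𝐋 𝐔 compat (IsLTolerance.refl tolerance) u

  ≡𝟙-by : ∀ {a} → (_⁺ 𝐋 𝐔 _∼_) (u ≈_) (u ∼_) ≤ a → a ≡ 𝟙
  ≡𝟙-by ⁺≤a = 𝟙≤⇒≡𝟙 𝐋 (≤-trans (≡⇒≤ 𝐋 (sym ∼⁺≡𝟙)) ⁺≤a)
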